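{- Let $K \ge 1$ be an integer and let $T$ be a rooted tree with $n$ nodes, in which the children of each non-leaf node $v$ are listed in an arbitrary fixed order $v_1, \ldots, v_{d_v}$. Then $$\sum_{v \text{ non-leaf}} \ \sum_{i=1}^{d_v - 1} \min\{n_{v_1} + n_{v_2} + \cdots + n_{v_i}, K\}\cdot \min\{n_{v_{i+1}}, K\} \le 2Kn.$$
   Context: $n_v$ denotes the number of descendants of $v$ in $T$, including $v$ itself; $d_v$ denotes the number of children of $v$. -}

module Defs where

open import Data.Nat using (ℕ; zero; suc; _+_; _*_; _⊓_)
open import Data.List using (List; []; _∷_)

data Tree : Set where
  node : List Tree → Tree

mutual
  size : Tree → ℕ
  size (node cs) = suc (sizes cs)

  sizes : List Tree → ℕ
  sizes []       = 0
  sizes (c ∷ cs) = size c + sizes cs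

-- Inner sum at a node with children c₁ … c_d, given the prefix size
-- p = n_{c₁} + … + n_{cᵢ} already consumed and the remaining children
-- c_{i+1}, …, c_d:
--   Σ_{j=i}^{d-1} min(n_{c₁}+…+n_{cⱼ}, K) · min(n_{c_{j+1}}, K)
innerSum : ℕ → ℕ → List Tree → ℕ
innerSum K p []       = 0
innerSum K p (c ∷ cs) = (p ⊓ K) * (size c ⊓ K) + innerSum K (p + size c) cs

nodeSum : ℕ → List Tree → ℕ
nodeSum K []       = 0
nodeSum K (c ∷ cs) = innerSum K (size c) cs

mutual
  -- Sum of nodeSum over all nodes v of the tree (leaves contribute 0,
  -- matching the restriction to non-leaf v).
  totalSum : ℕ → Tree → ℕ
  totalSum K (node cs) = nodeSum K cs + totalSums K cs

  totalSums : ℕ → List Tree → ℕ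
  totalSums K []       = 0
  totalSums K (c ∷ cs) = totalSum K c + totalSums K cs

-- Write g(n) = min(n, K) and Φ(n) = 2n·g(n) − g(n)², so Φ(n) = n² for n ≤ K and Φ grows
-- linearly with slope 2K beyond K; in particular Φ(n) ≤ 2Kn.  Assemble the tree bottom-up:
-- at each node the subtrees of the children are glued to one another from left to right and
-- finally the node itself is glued on, and gluing pieces of sizes a and b is charged g(a)·g(b).
-- The charges of the non-final gluings are exactly the terms of the sum, and the charges never
-- exceed the potential because Φ(a) + Φ(b) + g(a)·g(b) ≤ Φ(a + b).
module Submission where

open import Data.Nat using (ℕ; zero; suc; _+_; _*_; _⊓_; _≤_; z≤n; s≤s)
open import Data.Nat.Properties
open import Data.Nat.Tactic.RingSolver using (solve; solve-∀)
open import Data.List using ([]; _∷_)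
open import Data.Product using (_,_)
open import Data.Sum using (inj₁; inj₂)
open import Relation.Binary.PropositionalEquality using (_≡_; refl; sym; trans; subst₂)

open import Defs

-- Φ(a) + Φ(b) + x·y ≤ Φ(a + b), where x, y, z are the caps of a, b, a + b and every
-- subtraction of Φ has been moved to the other side.
MergeBound : (a b x y z : ℕ) → Set
MergeBound a b x y z =
  2 * a * x + 2 * b * y + x * y + z * z ≤ 2 * (a + b) * z + x * x + y * y

MergeBound-swap : ∀ {a b x y z} → MergeBound a b x y z → MergeBound b a y x z
MergeBound-swap {a} {b} {x} {y} {z} = subst₂ _≤_ (lhs-comm a b x y z) (rhs-comm a b x y z)
  where
  lhs-comm : ∀ a b x y z →
    2 * a * x + 2 * b * y + x * y + z * z ≡ 2 * b * y + 2 * a * x + y * x + z * z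
  lhs-comm = solve-∀
  rhs-comm : ∀ a b x y z →
    2 * (a + b) * z + x * x + y * y ≡ 2 * (b + a) * z + y * y + x * x
  rhs-comm = solve-∀

mergeBound-uncapped : ∀ a b → MergeBound a b a b (a + b)
mergeBound-uncapped a b = ≤‴⇒≤ (m≤‴m+k {k = a * b} (solve (a ∷ b ∷ [])))

mergeBound-capped : ∀ K a b → MergeBound a b K K K
mergeBound-capped K a b = ≤‴⇒≤ (m≤‴m+k {k = 0} (solve (K ∷ a ∷ b ∷ [])))

mergeBound-straddling : ∀ {K a b} → a ≤ K → b ≤ K → K ≤ a + b → MergeBound a b a b K
mergeBound-straddling {K} {a} {b} a≤K b≤K K≤a+b
  with s , refl ← m≤n⇒∃[o]m+o≡n a≤K
  with u , refl ← m≤n⇒∃[o]m+o≡n (+-cancelˡ-≤ a s b K≤a+b)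
  with w , refl ← m≤n⇒∃[o]m+o≡n (+-cancelˡ-≤ s u a (≤-trans b≤K (≤-reflexive (+-comm a s))))
  = ≤‴⇒≤ (m≤‴m+k {k = u * s + u * w + s * w} (solve (u ∷ w ∷ s ∷ [])))

mergeBound-halfCapped : ∀ {K a b} → a ≤ K → K ≤ b → MergeBound a b a K K
mergeBound-halfCapped {K} {a} {b} a≤K K≤b
  with s , refl ← m≤n⇒∃[o]m+o≡n a≤K
  with t , refl ← m≤n⇒∃[o]m+o≡n K≤b
  = ≤‴⇒≤ (m≤‴m+k {k = a * s} (solve (a ∷ s ∷ t ∷ [])))

mergeBound : ∀ K a b → MergeBound a b (a ⊓ K) (b ⊓ K) ((a + b) ⊓ K)
mergeBound K a b with ≤-total (a + b) K
... | inj₁ a+b≤K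
  rewrite m≤n⇒m⊓n≡m a+b≤K
        | m≤n⇒m⊓n≡m (m+n≤o⇒m≤o a a+b≤K)
        | m≤n⇒m⊓n≡m (m+n≤o⇒n≤o a a+b≤K)
  = mergeBound-uncapped a b
... | inj₂ K≤a+b rewrite m≥n⇒m⊓n≡n K≤a+b with ≤-total a K | ≤-total b K
...   | inj₁ a≤K | inj₁ b≤K rewrite m≤n⇒m⊓n≡m a≤K | m≤n⇒m⊓n≡m b≤K =
  mergeBound-straddling a≤K b≤K K≤a+b
...   | inj₁ a≤K | inj₂ K≤b rewrite m≤n⇒m⊓n≡m a≤K | m≥n⇒m⊓n≡n K≤b =
  mergeBound-halfCapped a≤K K≤b
...   | inj₂ K≤a | inj₁ b≤K rewrite m≥n⇒m⊓n≡n K≤a | m≤n⇒m⊓n≡m b≤K =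
  MergeBound-swap {b} {a} {b} {K} {K} (mergeBound-halfCapped b≤K K≤a)
...   | inj₂ K≤a | inj₂ K≤b rewrite m≥n⇒m⊓n≡n K≤a | m≥n⇒m⊓n≡n K≤b =
  mergeBound-capped K a b

-- A ≤Φ[ K ] n  says  A ≤ Φ(n), again with the subtraction moved across.
infix 4 _≤Φ[_]_
record _≤Φ[_]_ (A K n : ℕ) : Set where
  constructor ≤Φ-intro
  field
    ≤Φ-elim : A + (n ⊓ K) * (n ⊓ K) ≤ 2 * n * (n ⊓ K)

≤Φ-anti-mono : ∀ {K A B n} → B ≤ A → A ≤Φ[ K ] n → B ≤Φ[ K ] n
≤Φ-anti-mono B≤A (≤Φ-intro A≤Φn) = ≤Φ-intro (≤-trans (+-monoˡ-≤ _ B≤A) A≤Φn)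

≤Φ-single : ∀ K → 0 ≤Φ[ K ] 1
≤Φ-single zero    = ≤Φ-intro z≤n
≤Φ-single (suc _) = ≤Φ-intro (s≤s z≤n)

≤Φ-merge : ∀ {K A B a b} → A ≤Φ[ K ] a → B ≤Φ[ K ] b →
           A + B + (a ⊓ K) * (b ⊓ K) ≤Φ[ K ] a + b
≤Φ-merge {K} {A} {B} {a} {b} (≤Φ-intro A≤Φa) (≤Φ-intro B≤Φb) =
  ≤Φ-intro (+-cancelʳ-≤ (x * x + y * y) _ _ bound)
  where
  open ≤-Reasoning
  x = a ⊓ K
  y = b ⊓ K
  z = (a + b) ⊓ K
  regroup : ∀ A B x y z →
    A + B + x * y + z * z + (x * x + y * y) ≡ (A + x * x) + (B + y * y) + x * y + z * z
  regroup = solve-∀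
  bound : A + B + x * y + z * z + (x * x + y * y) ≤ 2 * (a + b) * z + (x * x + y * y)
  bound = begin
    A + B + x * y + z * z + (x * x + y * y)    ≡⟨ regroup A B x y z ⟩
    (A + x * x) + (B + y * y) + x * y + z * z  ≤⟨ +-monoˡ-≤ _ (+-monoˡ-≤ _ (+-mono-≤ A≤Φa B≤Φb)) ⟩
    2 * a * x + 2 * b * y + x * y + z * z      ≤⟨ mergeBound K a b ⟩
    2 * (a + b) * z + x * x + y * y            ≡⟨ +-assoc (2 * (a + b) * z) (x * x) (y * y) ⟩
    2 * (a + b) * z + (x * x + y * y)          ∎

≤Φ-bound : ∀ {K A n} → A ≤Φ[ K ] n → A ≤ 2 * K * n
≤Φ-bound {K} {A} {n} (≤Φ-intro A≤Φn) = begin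
  A                           ≤⟨ m≤m+n A _ ⟩
  A + (n ⊓ K) * (n ⊓ K)       ≤⟨ A≤Φn ⟩
  2 * n * (n ⊓ K)             ≤⟨ *-monoʳ-≤ (2 * n) (m⊓n≤n n K) ⟩
  2 * n * K                   ≡⟨ solve (n ∷ K ∷ []) ⟩
  2 * K * n                   ∎
  where open ≤-Reasoning

mutual
  totalSum-≤Φ : ∀ K T → totalSum K T ≤Φ[ K ] size T
  totalSum-≤Φ K (node [])       = ≤Φ-single K
  totalSum-≤Φ K (node (c ∷ cs)) =
    ≤Φ-anti-mono (≤-trans (≤-reflexive (regroup (totalSum K c) (innerSum K (size c) cs) (totalSums K cs)))
                          (m≤m+n _ _))
      (≤Φ-merge (≤Φ-single K) (children-≤Φ K (size c) cs (totalSum-≤Φ K c)))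
    where
    regroup : ∀ t i s → i + (t + s) ≡ t + i + s
    regroup = solve-∀

  -- The first children, of total size p, have already been glued into a piece costing A.
  children-≤Φ : ∀ K {A} p cs → A ≤Φ[ K ] p →
                A + innerSum K p cs + totalSums K cs ≤Φ[ K ] p + sizes cs
  children-≤Φ K {A} p [] A≤Φp =
    subst₂ _≤Φ[ K ]_ (sym (trans (+-identityʳ (A + 0)) (+-identityʳ A))) (sym (+-identityʳ p)) A≤Φp
  children-≤Φ K {A} p (c ∷ cs) A≤Φp =
    subst₂ _≤Φ[ K ]_ (regroup A (totalSum K c) ((p ⊓ K) * (size c ⊓ K)) (innerSum K (p + size c) cs)
                              (totalSums K cs))
                     (+-assoc p (size c) (sizes cs))
      (children-≤Φ K (p + size c) cs (≤Φ-merge A≤Φp (totalSum-≤Φ K c)))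
    where
    regroup : ∀ A t q i s → A + t + q + i + s ≡ A + (q + i) + (t + s)
    regroup = solve-∀

corollary1 : (K : ℕ) → 1 ≤ K → (T : Tree) →
    totalSum K T ≤ 2 * K * size T
corollary1 K _ T = ≤Φ-bound (totalSum-≤Φ K T)
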